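{- Let $x_1:A_1,\dots,x_k:A_k$ be a context and let $t$ be a term and $A$ a formula. If the sequent $x_1:A_1,\dots,x_k:A_k\vdash t:A$ is derivable in $\mathbf{IL_{at}}$, then the term $t$ of $A$ from $x_1:A_1,\dots,x_k:A_k$ is valid in every phase model $(D_{\mathcal M},*)$, i.e. for every phase model and all $(m_i\rhd t_i)\in A_i^*$ ($1\le i\le k$) we have $(m_1\cdots m_k\rhd t[x_1:=t_1,\dots,x_k:=t_k])\in A^*$.
   Context: System $\mathbf{IL_{at}}$ (atomic second-order intuitionistic propositional logic). Formulas: $A,B::=X\mid A\to B\mid \forall X.A$, with $X$ ranging over atoms (propositional variables). Terms: $t,s::=x\mid c^A\mid \lambda x.t\mid ts\mid \Lambda X.t\mid tX$, where $x$ ranges over term-variables, there is a term-constant $c^A$ for every formula $A$, and in $tX$ the argument $X$ is an atom. Terms and formulas are taken up to $\alpha$-equivalence; substitutions $t[x:=s]$, $t[X:=Y]$, $A[X:=B]$ are capture-avoiding. $tFV(t)$ is the set of free term-variables of $t$. A context is a finite set $x_1:A_1,\dots,x_n:A_n$ with distinct term-variables; $PFV(\Gamma)$ is the set of free propositional variables of $A_1,\dots,A_n$. Derivable sequents $\Gamma\vdash t:A$ are generated by: $\Gamma,x:A\vdash x:A$; $\Gamma\vdash c^A:A$ (for every $A$); from $\Gamma,x:A\vdash t:B$ infer $\Gamma\vdash\lambda x.t:A\to B$; from $\Gamma\vdash t:A\to B$ and $\Gamma\vdash s:A$ infer $\Gamma\vdash ts:B$; from $\Gamma\vdash t:A$ with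 $X\notin PFV(\Gamma)$ infer $\Gamma\vdash\Lambda X.t:\forall X.A$; from $\Gamma\vdash t:\forall X.A$ infer $\Gamma\vdash tY:A[X:=Y]$ for any atom $Y$. Phase space: an idempotent commutative monoid $\mathcal M=(M,\cdot,\varepsilon)$; domain $B_{\mathcal M}=\{(m\rhd t)\mid m\in M, t \text{ a term}\}$; and a family $D_{\mathcal M}\subseteq\mathcal P(B_{\mathcal M})$ of "closed sets" $\alpha$ satisfying: (Monotonicity) if $(m\rhd t)\in\alpha$ then $(m\cdot n\rhd t)\in\alpha$ for all $n\in M$; (Expansion) for any $T_1,\dots,T_k$ each a term or an atom, (i) if $(m\rhd t[x:=s]T_1\cdots T_k)\in\alpha$ then $(m\rhd(\lambda x.t)sT_1\cdots T_k)\in\alpha$, and (ii) if $(m\rhd t[X:=Y]T_1\cdots T_k)\in\alpha$ then $(m\rhd(\Lambda X.t)YT_1\cdots T_k)\in\alpha$. Phase model $(D_{\mathcal M},*)$: a phase space with an interpretation of formulas such that $X^*\in D_{\mathcal M}$ for every atom $X$; $(A\to B)^*=\{(m\rhd t)\mid (m\cdot n\rhd ts)\in B^*\text{ for all }(n\rhd s)\in A^*\}$; $(\forall X.A)^*=\{(m\rhd t)\mid (m\rhd tY)\in (A[X:=Y])^*\text{ for every atom }Y\}$; and $(\varepsilon\rhd c^A)\in A^*$ for every formula $A$. Validity: a term $t$ of $A$ from $x_1:A_1,\dots,x_k:A_k$ with $tFV(t)\subseteq\{x_1,\dots,x_k\}$ is valid in $(D_{\mathcal M},*)$ iff $(m_1\cdots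 m_k\rhd t[x_1:=t_1,\dots,x_k:=t_k])\in A^*$ for all $(m_i\rhd t_i)\in A_i^*$. -}

module Defs where

open import Level using (Level; _⊔_) renaming (suc to lsuc)
open import Data.Nat using (ℕ; zero; suc)
open import Data.List using (List; []; _∷_; map; foldl)
open import Relation.Unary using (Pred; _∈_)
open import Relation.Binary.PropositionalEquality using (_≡_)
open import Algebra.Core using (Op₂)
open import Algebra.Structures using (IsIdempotentCommutativeMonoid)
open import Data.List.Relation.Binary.Pointwise using (Pointwise)
open import Function.Bundles using (_⇔_)

-- Syntax, de Bruijn style (terms/formulas up to α-equivalence).
-- Atoms (propositional variables) are de Bruijn indices ℕ; at top level
-- the free atom  at n  is the n-th atom.  Term-variables are likewise
-- indices into the context.

infixr 7 _⇒_
data Fm : Set where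
  at  : ℕ → Fm
  _⇒_ : Fm → Fm → Fm
  ∀'  : Fm → Fm            -- ∀X.A  (X is index 0 in the body)

ext : (ℕ → ℕ) → ℕ → ℕ
ext ρ zero    = zero
ext ρ (suc n) = suc (ρ n)

renF : (ℕ → ℕ) → Fm → Fm
renF ρ (at X)  = at (ρ X)
renF ρ (A ⇒ B) = renF ρ A ⇒ renF ρ B
renF ρ (∀' A)  = ∀' (renF (ext ρ) A)

inst : ℕ → ℕ → ℕ
inst Y zero    = Y
inst Y (suc n) = n

_[at_] : Fm → ℕ → Fm
A [at Y ] = renF (inst Y) A

infixl 8 _·_ _·at_
data Tm : Set where
  var   : ℕ → Tm
  cst   : Fm → Tm
  lam   : Tm → Tm
  _·_   : Tm → Tm → Tm
  Lam   : Tm → Tm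
  _·at_ : Tm → ℕ → Tm

renAt : (ℕ → ℕ) → Tm → Tm
renAt ρ (var x)    = var x
renAt ρ (cst A)    = cst (renF ρ A)
renAt ρ (lam t)    = lam (renAt ρ t)
renAt ρ (t · s)    = renAt ρ t · renAt ρ s
renAt ρ (Lam t)    = Lam (renAt (ext ρ) t)
renAt ρ (t ·at Y)  = renAt ρ t ·at ρ Y

renT : (ℕ → ℕ) → Tm → Tm
renT ρ (var x)    = var (ρ x)
renT ρ (cst A)    = cst A
renT ρ (lam t)    = lam (renT (ext ρ) t)
renT ρ (t · s)    = renT ρ t · renT ρ s
renT ρ (Lam t)    = Lam (renT ρ t)
renT ρ (t ·at Y)  = renT ρ t ·at Y

exts : (ℕ → Tm) → ℕ → Tm
exts σ zero    = var zero
exts σ (suc x) = renT suc (σ x)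

subT : (ℕ → Tm) → Tm → Tm
subT σ (var x)   = σ x
subT σ (cst A)   = cst A
subT σ (lam t)   = lam (subT (exts σ) t)
subT σ (t · s)   = subT σ t · subT σ s
subT σ (Lam t)   = Lam (subT (λ x → renAt suc (σ x)) t)
subT σ (t ·at Y) = subT σ t ·at Y

single : Tm → ℕ → Tm
single s zero    = s
single s (suc x) = var x

_[_] : Tm → Tm → Tm
t [ s ] = subT (single s) t

_[atT_] : Tm → ℕ → Tm
t [atT Y ] = renAt (inst Y) t

data Arg : Set where
  tm  : Tm → Arg
  atm : ℕ → Arg

applyArg : Tm → Arg → Tm
applyArg t (tm s)  = t · s
applyArg t (atm Y) = t ·at Y

spine : Tm → List Arg → Tm
spine = foldl applyArg

-- Typing in IL_at.  A context x₁:A₁,…,x_k:A_k is the list A₁ ∷ … ∷ A_k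
-- (x_i is index i-1).

infix 4 _∋_∶_ _⊢_∶_
data _∋_∶_ : List Fm → ℕ → Fm → Set where
  here  : ∀ {Γ A} → A ∷ Γ ∋ zero ∶ A
  there : ∀ {Γ A B x} → Γ ∋ x ∶ A → B ∷ Γ ∋ suc x ∶ A

data _⊢_∶_ : List Fm → Tm → Fm → Set where
  ax   : ∀ {Γ x A} → Γ ∋ x ∶ A → Γ ⊢ var x ∶ A
  con  : ∀ {Γ A} → Γ ⊢ cst A ∶ A
  ⇒I   : ∀ {Γ t A B} → A ∷ Γ ⊢ t ∶ B → Γ ⊢ lam t ∶ A ⇒ B
  ⇒E   : ∀ {Γ t s A B} → Γ ⊢ t ∶ A ⇒ B → Γ ⊢ s ∶ A → Γ ⊢ t · s ∶ B
  -- eigenvariable condition X ∉ PFV(Γ): Γ is shifted so the fresh atom 0 is not in it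
  ∀I   : ∀ {Γ t A} → map (renF suc) Γ ⊢ t ∶ A → Γ ⊢ Lam t ∶ ∀' A
  ∀E   : ∀ {Γ t A} (Y : ℕ) → Γ ⊢ t ∶ ∀' A → Γ ⊢ t ·at Y ∶ A [at Y ]

record IdemCommMonoid c : Set (lsuc c) where
  infixl 7 _∙_
  field
    Carrier : Set c
    _∙_     : Op₂ Carrier
    ε       : Carrier
    isIdemCommMonoid : IsIdempotentCommutativeMonoid {A = Carrier} _≡_ _∙_ ε

module _ {c} (M : IdemCommMonoid c) where
  open IdemCommMonoid M

  infix 5 _▷_
  record Elem : Set c where
    constructor _▷_
    field
      mon  : Carrier
      term : Tm

  record PhaseSpace ℓ d : Set (c ⊔ lsuc ℓ ⊔ lsuc d) where
    field
      D : Pred (Pred Elem ℓ) d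
      monotone : ∀ {α} → D α → ∀ {m t} → (m ▷ t) ∈ α → ∀ n → (m ∙ n ▷ t) ∈ α
      expandλ  : ∀ {α} → D α → ∀ {m t s Ts} →
                 (m ▷ spine (t [ s ]) Ts) ∈ α → (m ▷ spine (lam t · s) Ts) ∈ α
      expandΛ  : ∀ {α} → D α → ∀ {m t Y Ts} →
                 (m ▷ spine (t [atT Y ]) Ts) ∈ α → (m ▷ spine (Lam t ·at Y) Ts) ∈ α

module _ {c ℓ d} {M : IdemCommMonoid c} (S : PhaseSpace M ℓ d) where
  open IdemCommMonoid M
  open PhaseSpace S

  record PhaseModel : Set (c ⊔ lsuc ℓ ⊔ lsuc d) where
    field
      ⟦_⟧   : Fm → Pred (Elem M) ℓ
      atD   : ∀ X → D ⟦ at X ⟧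
      ⇒-eq  : ∀ A B m t →
              ((m ▷ t) ∈ ⟦ A ⇒ B ⟧) ⇔
              (∀ n s → (n ▷ s) ∈ ⟦ A ⟧ → (m ∙ n ▷ t · s) ∈ ⟦ B ⟧)
      ∀-eq  : ∀ A m t →
              ((m ▷ t) ∈ ⟦ ∀' A ⟧) ⇔ (∀ (Y : ℕ) → (m ▷ t ·at Y) ∈ ⟦ A [at Y ] ⟧)
      const : ∀ A → (ε ▷ cst A) ∈ ⟦ A ⟧

module _ {c ℓ d} {M : IdemCommMonoid c} {S : PhaseSpace M ℓ d} (PM : PhaseModel S) where
  open IdemCommMonoid M
  open PhaseModel PM
  open Elem

  prod : List (Elem M) → Carrier
  prod []       = ε
  prod (e ∷ ρ)  = mon e ∙ prod ρ

  closeSub : List (Elem M) → ℕ → Tm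
  closeSub []      x       = var x
  closeSub (e ∷ ρ) zero    = term e
  closeSub (e ∷ ρ) (suc x) = closeSub ρ x

  Valid : List Fm → Tm → Fm → Set (c ⊔ ℓ)
  Valid Γ t A = ∀ (ρ : List (Elem M)) →
                Pointwise (λ Ai ei → ei ∈ ⟦ Ai ⟧) Γ ρ →
                (prod ρ ▷ subT (closeSub ρ) t) ∈ ⟦ A ⟧

{-# OPTIONS --safe #-}
-- Every A* is closed: monotone and closed under head expansion.  This goes by
-- induction on A, generalised over atom renamings so that every A[X:=Y] is
-- covered by the hypothesis for A; the closure conditions pass from B* to
-- (A → B)* and from all A[X:=Y]* to (∀X.A)* by extending the spine with one
-- more argument.  Soundness is then an induction on derivations: closure under
-- expansion validates →I and ∀I, and idempotency of the monoid lets both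
-- premises of →E share the context's m₁⋯m_k.  Since the eigenvariable of ∀I is
-- instantiated by arbitrary atoms Y, this induction too runs over all atom
-- renamings of the derivation at once.
module Submission where

open import Defs
open import Level using (_⊔_)
open import Function.Base using (id; _∘_)
open import Function.Bundles using (module Equivalence)
open import Data.Nat using (zero; suc)
open import Data.List using (List; []; _∷_; _∷ʳ_; map)
open import Data.List.Properties using (foldl-∷ʳ; map-cong; map-∘; map-id)
open import Data.List.Relation.Binary.Pointwise using (Pointwise; []; _∷_)
open import Relation.Unary using (Pred; _∈_)
open import Relation.Binary.PropositionalEquality
  using (_≡_; _≗_; refl; sym; trans; cong; cong₂; subst; subst₂; module ≡-Reasoning)
open import Algebra.Bundles using (IdempotentCommutativeMonoid)
import Algebra.Properties.CommutativeSemigroup as CommutativeSemigroupProperties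

open Equivalence using (to; from)

ext-cong : ∀ {f g} → f ≗ g → ext f ≗ ext g
ext-cong f≗g zero    = refl
ext-cong f≗g (suc x) = cong suc (f≗g x)

ext-∘ : ∀ {f g} → ext (f ∘ g) ≗ ext f ∘ ext g
ext-∘ zero    = refl
ext-∘ (suc x) = refl

ext-id : ext id ≗ id
ext-id zero    = refl
ext-id (suc x) = refl

inst-ext : ∀ f Y → inst (f Y) ∘ ext f ≗ f ∘ inst Y
inst-ext f Y zero    = refl
inst-ext f Y (suc x) = refl

renF-cong : ∀ {f g} → f ≗ g → ∀ A → renF f A ≡ renF g A
renF-cong f≗g (at X)  = cong at (f≗g X)
renF-cong f≗g (A ⇒ B) = cong₂ _⇒_ (renF-cong f≗g A) (renF-cong f≗g B)
renF-cong f≗g (∀' A)  = cong ∀' (renF-cong (ext-cong f≗g) A)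

renF-∘ : ∀ f g A → renF (f ∘ g) A ≡ renF f (renF g A)
renF-∘ f g (at X)  = refl
renF-∘ f g (A ⇒ B) = cong₂ _⇒_ (renF-∘ f g A) (renF-∘ f g B)
renF-∘ f g (∀' A)  = cong ∀' (trans (renF-cong ext-∘ A) (renF-∘ (ext f) (ext g) A))

renF-id : ∀ A → renF id A ≡ A
renF-id (at X)  = refl
renF-id (A ⇒ B) = cong₂ _⇒_ (renF-id A) (renF-id B)
renF-id (∀' A)  = cong ∀' (trans (renF-cong ext-id A) (renF-id A))

renF-inst : ∀ f A Y → renF f (A [at Y ]) ≡ renF (ext f) A [at f Y ]
renF-inst f A Y = begin
  renF f (renF (inst Y) A)         ≡⟨ renF-∘ f (inst Y) A ⟨
  renF (f ∘ inst Y) A              ≡⟨ renF-cong (inst-ext f Y) A ⟨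
  renF (inst (f Y) ∘ ext f) A      ≡⟨ renF-∘ (inst (f Y)) (ext f) A ⟩
  renF (inst (f Y)) (renF (ext f) A) ∎
  where open ≡-Reasoning

map-renF-id : ∀ Γ → map (renF id) Γ ≡ Γ
map-renF-id Γ = trans (map-cong renF-id Γ) (map-id Γ)

map-renF-∘ : ∀ f g Γ → map (renF f) (map (renF g) Γ) ≡ map (renF (f ∘ g)) Γ
map-renF-∘ f g Γ =
  trans (sym (map-∘ Γ)) (map-cong (λ A → sym (renF-∘ f g A)) Γ)

∋-renF : ∀ f {Γ x A} → Γ ∋ x ∶ A → map (renF f) Γ ∋ x ∶ renF f A
∋-renF f here      = here
∋-renF f (there i) = there (∋-renF f i)

renAt-cong : ∀ {f g} → f ≗ g → ∀ t → renAt f t ≡ renAt g t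
renAt-cong f≗g (var x)   = refl
renAt-cong f≗g (cst A)   = cong cst (renF-cong f≗g A)
renAt-cong f≗g (lam t)   = cong lam (renAt-cong f≗g t)
renAt-cong f≗g (t · s)   = cong₂ _·_ (renAt-cong f≗g t) (renAt-cong f≗g s)
renAt-cong f≗g (Lam t)   = cong Lam (renAt-cong (ext-cong f≗g) t)
renAt-cong f≗g (t ·at Y) = cong₂ _·at_ (renAt-cong f≗g t) (f≗g Y)

renAt-∘ : ∀ f g t → renAt (f ∘ g) t ≡ renAt f (renAt g t)
renAt-∘ f g (var x)   = refl
renAt-∘ f g (cst A)   = cong cst (renF-∘ f g A)
renAt-∘ f g (lam t)   = cong lam (renAt-∘ f g t)
renAt-∘ f g (t · s)   = cong₂ _·_ (renAt-∘ f g t) (renAt-∘ f g s)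
renAt-∘ f g (Lam t)   = cong Lam (trans (renAt-cong ext-∘ t) (renAt-∘ (ext f) (ext g) t))
renAt-∘ f g (t ·at Y) = cong (_·at f (g Y)) (renAt-∘ f g t)

renAt-id : ∀ t → renAt id t ≡ t
renAt-id (var x)   = refl
renAt-id (cst A)   = cong cst (renF-id A)
renAt-id (lam t)   = cong lam (renAt-id t)
renAt-id (t · s)   = cong₂ _·_ (renAt-id t) (renAt-id s)
renAt-id (Lam t)   = cong Lam (trans (renAt-cong ext-id t) (renAt-id t))
renAt-id (t ·at Y) = cong (_·at Y) (renAt-id t)

renT-cong : ∀ {f g} → f ≗ g → ∀ t → renT f t ≡ renT g t
renT-cong f≗g (var x)   = cong var (f≗g x)
renT-cong f≗g (cst A)   = refl
renT-cong f≗g (lam t)   = cong lam (renT-cong (ext-cong f≗g) t)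
renT-cong f≗g (t · s)   = cong₂ _·_ (renT-cong f≗g t) (renT-cong f≗g s)
renT-cong f≗g (Lam t)   = cong Lam (renT-cong f≗g t)
renT-cong f≗g (t ·at Y) = cong (_·at Y) (renT-cong f≗g t)

renT-∘ : ∀ f g t → renT (f ∘ g) t ≡ renT f (renT g t)
renT-∘ f g (var x)   = refl
renT-∘ f g (cst A)   = refl
renT-∘ f g (lam t)   = cong lam (trans (renT-cong ext-∘ t) (renT-∘ (ext f) (ext g) t))
renT-∘ f g (t · s)   = cong₂ _·_ (renT-∘ f g t) (renT-∘ f g s)
renT-∘ f g (Lam t)   = cong Lam (renT-∘ f g t)
renT-∘ f g (t ·at Y) = cong (_·at Y) (renT-∘ f g t)

renAt-renT : ∀ h r t → renAt h (renT r t) ≡ renT r (renAt h t)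
renAt-renT h r (var x)   = refl
renAt-renT h r (cst A)   = refl
renAt-renT h r (lam t)   = cong lam (renAt-renT h (ext r) t)
renAt-renT h r (t · s)   = cong₂ _·_ (renAt-renT h r t) (renAt-renT h r s)
renAt-renT h r (Lam t)   = cong Lam (renAt-renT (ext h) r t)
renAt-renT h r (t ·at Y) = cong (_·at h Y) (renAt-renT h r t)

exts-cong : ∀ {σ τ} → σ ≗ τ → exts σ ≗ exts τ
exts-cong σ≗τ zero    = refl
exts-cong σ≗τ (suc x) = cong (renT suc) (σ≗τ x)

subT-cong : ∀ {σ τ} → σ ≗ τ → ∀ t → subT σ t ≡ subT τ t
subT-cong σ≗τ (var x)   = σ≗τ x
subT-cong σ≗τ (cst A)   = refl
subT-cong σ≗τ (lam t)   = cong lam (subT-cong (exts-cong σ≗τ) t)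
subT-cong σ≗τ (t · s)   = cong₂ _·_ (subT-cong σ≗τ t) (subT-cong σ≗τ s)
subT-cong σ≗τ (Lam t)   = cong Lam (subT-cong (cong (renAt suc) ∘ σ≗τ) t)
subT-cong σ≗τ (t ·at Y) = cong (_·at Y) (subT-cong σ≗τ t)

exts-var : exts var ≗ var
exts-var zero    = refl
exts-var (suc x) = refl

subT-var : ∀ t → subT var t ≡ t
subT-var (var x)   = refl
subT-var (cst A)   = refl
subT-var (lam t)   = cong lam (trans (subT-cong exts-var t) (subT-var t))
subT-var (t · s)   = cong₂ _·_ (subT-var t) (subT-var s)
subT-var (Lam t)   = cong Lam (subT-var t)
subT-var (t ·at Y) = cong (_·at Y) (subT-var t)

subT-renT : ∀ τ r t → subT τ (renT r t) ≡ subT (τ ∘ r) t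
subT-renT τ r (var x)   = refl
subT-renT τ r (cst A)   = refl
subT-renT τ r (lam t)   =
  cong lam (trans (subT-renT (exts τ) (ext r) t) (subT-cong (λ { zero → refl ; (suc x) → refl }) t))
subT-renT τ r (t · s)   = cong₂ _·_ (subT-renT τ r t) (subT-renT τ r s)
subT-renT τ r (Lam t)   = cong Lam (subT-renT (renAt suc ∘ τ) r t)
subT-renT τ r (t ·at Y) = cong (_·at Y) (subT-renT τ r t)

renT-subT : ∀ r τ t → renT r (subT τ t) ≡ subT (renT r ∘ τ) t
renT-subT r τ (var x)   = refl
renT-subT r τ (cst A)   = refl
renT-subT r τ (lam t)   = cong lam (trans (renT-subT (ext r) (exts τ) t) (subT-cong exts-renT t))
  where
    exts-renT : renT (ext r) ∘ exts τ ≗ exts (renT r ∘ τ)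
    exts-renT zero    = refl
    exts-renT (suc x) = trans (sym (renT-∘ (ext r) suc (τ x))) (renT-∘ suc r (τ x))
renT-subT r τ (t · s)   = cong₂ _·_ (renT-subT r τ t) (renT-subT r τ s)
renT-subT r τ (Lam t)   =
  cong Lam (trans (renT-subT r (renAt suc ∘ τ) t) (subT-cong (sym ∘ renAt-renT suc r ∘ τ) t))
renT-subT r τ (t ·at Y) = cong (_·at Y) (renT-subT r τ t)

renAt-subT : ∀ h τ t → renAt h (subT τ t) ≡ subT (renAt h ∘ τ) (renAt h t)
renAt-subT h τ (var x)   = refl
renAt-subT h τ (cst A)   = refl
renAt-subT h τ (lam t)   =
  cong lam (trans (renAt-subT h (exts τ) t) (subT-cong renAt-exts (renAt h t)))
  where
    renAt-exts : renAt h ∘ exts τ ≗ exts (renAt h ∘ τ)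
    renAt-exts zero    = refl
    renAt-exts (suc x) = renAt-renT h suc (τ x)
renAt-subT h τ (t · s)   = cong₂ _·_ (renAt-subT h τ t) (renAt-subT h τ s)
renAt-subT h τ (Lam t)   =
  cong Lam (trans (renAt-subT (ext h) (renAt suc ∘ τ) t)
                  (subT-cong renAt-weaken (renAt (ext h) t)))
  where
    renAt-weaken : renAt (ext h) ∘ renAt suc ∘ τ ≗ renAt suc ∘ renAt h ∘ τ
    renAt-weaken x = trans (sym (renAt-∘ (ext h) suc (τ x))) (renAt-∘ suc h (τ x))
renAt-subT h τ (t ·at Y) = cong (_·at h Y) (renAt-subT h τ t)

subT-subT : ∀ τ σ t → subT τ (subT σ t) ≡ subT (subT τ ∘ σ) t
subT-subT τ σ (var x)   = refl
subT-subT τ σ (cst A)   = refl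
subT-subT τ σ (lam t)   = cong lam (trans (subT-subT (exts τ) (exts σ) t) (subT-cong subT-exts t))
  where
    subT-exts : subT (exts τ) ∘ exts σ ≗ exts (subT τ ∘ σ)
    subT-exts zero    = refl
    subT-exts (suc x) = trans (subT-renT (exts τ) suc (σ x)) (sym (renT-subT suc τ (σ x)))
subT-subT τ σ (t · s)   = cong₂ _·_ (subT-subT τ σ t) (subT-subT τ σ s)
subT-subT τ σ (Lam t)   =
  cong Lam (trans (subT-subT (renAt suc ∘ τ) (renAt suc ∘ σ) t)
                  (subT-cong (sym ∘ renAt-subT suc τ ∘ σ) t))
subT-subT τ σ (t ·at Y) = cong (_·at Y) (subT-subT τ σ t)

subT-single-weaken : ∀ s t → subT (single s) (renT suc t) ≡ t
subT-single-weaken s t = trans (subT-renT (single s) suc t) (subT-var t)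

renAt-inst-subT-weaken : ∀ Y σ t →
                         renAt (inst Y) (subT (renAt suc ∘ σ) t) ≡ subT σ (renAt (inst Y) t)
renAt-inst-subT-weaken Y σ t =
  trans (renAt-subT (inst Y) (renAt suc ∘ σ) t) (subT-cong inst-weaken (renAt (inst Y) t))
  where
    inst-weaken : renAt (inst Y) ∘ renAt suc ∘ σ ≗ σ
    inst-weaken x = trans (sym (renAt-∘ (inst Y) suc (σ x))) (renAt-id (σ x))

spine-∷ʳ : ∀ t Ts a → spine t (Ts ∷ʳ a) ≡ applyArg (spine t Ts) a
spine-∷ʳ t Ts a = foldl-∷ʳ applyArg t a Ts

infix 4 _↦_
data _↦_ : Tm → Tm → Set where
  β⇒ : ∀ {t s} → lam t · s ↦ t [ s ]
  β∀ : ∀ {t Y} → Lam t ·at Y ↦ t [atT Y ]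

module Soundness {c ℓ d} {M : IdemCommMonoid c} {S : PhaseSpace M ℓ d} (PM : PhaseModel S) where
  open IdemCommMonoid M
  open PhaseSpace S
  open PhaseModel PM
  open Elem

  idemCommMonoid : IdempotentCommutativeMonoid c c
  idemCommMonoid = record { isIdempotentCommutativeMonoid = isIdemCommMonoid }

  open IdempotentCommutativeMonoid idemCommMonoid using (comm; idem; identityˡ; commutativeSemigroup)
  open CommutativeSemigroupProperties commutativeSemigroup using (xy∙z≈xz∙y)

  record IsClosed (α : Pred (Elem M) ℓ) : Set (c ⊔ ℓ) where
    field
      mono   : ∀ {m t} → (m ▷ t) ∈ α → ∀ n → (m ∙ n ▷ t) ∈ α
      expand : ∀ {m r r′} → r ↦ r′ → ∀ Ts → (m ▷ spine r′ Ts) ∈ α → (m ▷ spine r Ts) ∈ α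

    monoˡ : ∀ {m t} → (m ▷ t) ∈ α → ∀ n → (n ∙ m ▷ t) ∈ α
    monoˡ {m} {t} m▷t n = subst (λ k → (k ▷ t) ∈ α) (comm m n) (mono m▷t n)

    expand-∷ʳ : ∀ {m r r′} → r ↦ r′ → ∀ Ts a →
                (m ▷ applyArg (spine r′ Ts) a) ∈ α → (m ▷ applyArg (spine r Ts) a) ∈ α
    expand-∷ʳ {m} {r} {r′} r↦r′ Ts a h =
      subst (λ u → (m ▷ u) ∈ α) (spine-∷ʳ r Ts a)
        (expand r↦r′ (Ts ∷ʳ a) (subst (λ u → (m ▷ u) ∈ α) (sym (spine-∷ʳ r′ Ts a)) h))

  open IsClosed

  D⇒IsClosed : ∀ {α} → D α → IsClosed α
  D⇒IsClosed Dα .mono        = monotone Dα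
  D⇒IsClosed Dα .expand β⇒ Ts = expandλ Dα {Ts = Ts}
  D⇒IsClosed Dα .expand β∀ Ts = expandΛ Dα {Ts = Ts}

  ⇒-isClosed : ∀ A B → IsClosed ⟦ B ⟧ → IsClosed ⟦ A ⇒ B ⟧
  ⇒-isClosed A B B-closed .mono {m} {t} h n = from (⇒-eq A B (m ∙ n) t) λ k s s∈A →
    subst (λ l → (l ▷ t · s) ∈ ⟦ B ⟧) (xy∙z≈xz∙y m k n)
      (mono B-closed (to (⇒-eq A B m t) h k s s∈A) n)
  ⇒-isClosed A B B-closed .expand {m} r↦r′ Ts h = from (⇒-eq A B m _) λ k s s∈A →
    expand-∷ʳ B-closed r↦r′ Ts (tm s) (to (⇒-eq A B m _) h k s s∈A)

  ∀-isClosed : ∀ A → (∀ Y → IsClosed ⟦ A [at Y ] ⟧) → IsClosed ⟦ ∀' A ⟧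
  ∀-isClosed A A-closed .mono {m} {t} h n = from (∀-eq A (m ∙ n) t) λ Y →
    mono (A-closed Y) (to (∀-eq A m t) h Y) n
  ∀-isClosed A A-closed .expand {m} r↦r′ Ts h = from (∀-eq A m _) λ Y →
    expand-∷ʳ (A-closed Y) r↦r′ Ts (atm Y) (to (∀-eq A m _) h Y)

  renF-isClosed : ∀ A f → IsClosed ⟦ renF f A ⟧
  renF-isClosed (at X)  f = D⇒IsClosed (atD (f X))
  renF-isClosed (A ⇒ B) f = ⇒-isClosed (renF f A) (renF f B) (renF-isClosed B f)
  renF-isClosed (∀' A)  f = ∀-isClosed (renF (ext f) A) λ Y →
    subst (IsClosed ∘ ⟦_⟧) (renF-∘ (inst Y) (ext f) A) (renF-isClosed A (inst Y ∘ ext f))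

  ⟦⟧-isClosed : ∀ A → IsClosed ⟦ A ⟧
  ⟦⟧-isClosed A = subst (IsClosed ∘ ⟦_⟧) (renF-id A) (renF-isClosed A id)

  _⊨_ : List (Elem M) → List Fm → Set (c ⊔ ℓ)
  ρ ⊨ Γ = Pointwise (λ A e → e ∈ ⟦ A ⟧) Γ ρ

  closeSub-∷ : ∀ e ρ t → subT (single (term e)) (subT (exts (closeSub PM ρ)) t)
                          ≡ subT (closeSub PM (e ∷ ρ)) t
  closeSub-∷ e ρ t =
    trans (subT-subT (single (term e)) (exts (closeSub PM ρ)) t) (subT-cong single-exts t)
    where
      single-exts : subT (single (term e)) ∘ exts (closeSub PM ρ) ≗ closeSub PM (e ∷ ρ)
      single-exts zero    = refl
      single-exts (suc x) = subT-single-weaken (term e) (closeSub PM ρ x)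

  ∋-valid : ∀ {Γ x A} ρ → ρ ⊨ Γ → Γ ∋ x ∶ A → (prod PM ρ ▷ closeSub PM ρ x) ∈ ⟦ A ⟧
  ∋-valid {A = A} (e ∷ ρ) (e∈A ∷ _)  here      = mono (⟦⟧-isClosed A) e∈A (prod PM ρ)
  ∋-valid {A = A} (e ∷ ρ) (_ ∷ ρ⊨Γ) (there i) = monoˡ (⟦⟧-isClosed A) (∋-valid ρ ρ⊨Γ i) (mon e)

  sound : ∀ {Γ t A} → Γ ⊢ t ∶ A → ∀ f → Valid PM (map (renF f) Γ) (renAt f t) (renF f A)
  sound (ax i) f ρ ρ⊨Γ = ∋-valid ρ ρ⊨Γ (∋-renF f i)
  sound (con {A = A}) f ρ _ =
    subst (λ m → (m ▷ cst (renF f A)) ∈ ⟦ renF f A ⟧) (identityˡ (prod PM ρ))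
      (mono (⟦⟧-isClosed (renF f A)) (const (renF f A)) (prod PM ρ))
  sound (⇒I {t = t} {A} {B} ⊢t) f ρ ρ⊨Γ =
    from (⇒-eq (renF f A) (renF f B) (prod PM ρ) _) λ n s s∈A →
      expand (⟦⟧-isClosed (renF f B)) β⇒ []
        (subst₂ (λ m u → (m ▷ u) ∈ ⟦ renF f B ⟧)
                (comm n (prod PM ρ)) (sym (closeSub-∷ (n ▷ s) ρ (renAt f t)))
                (sound ⊢t f ((n ▷ s) ∷ ρ) (s∈A ∷ ρ⊨Γ)))
  sound (⇒E {t = t} {s} {A} {B} ⊢t ⊢s) f ρ ρ⊨Γ =
    subst (λ m → (m ▷ subT σ (renAt f t) · subT σ (renAt f s)) ∈ ⟦ renF f B ⟧)
          (idem (prod PM ρ))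
          (to (⇒-eq (renF f A) (renF f B) (prod PM ρ) _) (sound ⊢t f ρ ρ⊨Γ)
              (prod PM ρ) _ (sound ⊢s f ρ ρ⊨Γ))
    where σ = closeSub PM ρ
  sound (∀I {Γ} {t} {A} ⊢t) f ρ ρ⊨Γ =
    from (∀-eq (renF (ext f) A) (prod PM ρ) _) λ Y →
      expand (⟦⟧-isClosed _) β∀ []
        (subst₂ (λ B u → (prod PM ρ ▷ u) ∈ ⟦ B ⟧) (renF-∘ (inst Y) (ext f) A) (term-eq Y)
                (sound ⊢t (inst Y ∘ ext f) ρ
                       (subst (ρ ⊨_) (sym (map-renF-∘ (inst Y ∘ ext f) suc Γ)) ρ⊨Γ)))
    where
      term-eq : ∀ Y → subT (closeSub PM ρ) (renAt (inst Y ∘ ext f) t)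
                    ≡ renAt (inst Y) (subT (renAt suc ∘ closeSub PM ρ) (renAt (ext f) t))
      term-eq Y = trans (cong (subT (closeSub PM ρ)) (renAt-∘ (inst Y) (ext f) t))
                        (sym (renAt-inst-subT-weaken Y (closeSub PM ρ) (renAt (ext f) t)))
  sound (∀E {A = A} Y ⊢t) f ρ ρ⊨Γ =
    subst (λ B → (prod PM ρ ▷ _) ∈ ⟦ B ⟧) (sym (renF-inst f A Y))
      (to (∀-eq (renF (ext f) A) (prod PM ρ) _) (sound ⊢t f ρ ρ⊨Γ) (f Y))

mainTheorem1 : ∀ {c ℓ d} {M : IdemCommMonoid c} {S : PhaseSpace M ℓ d}
                 (PM : PhaseModel S) (Γ : List Fm) (t : Tm) (A : Fm) →
                 Γ ⊢ t ∶ A → Valid PM Γ t A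
mainTheorem1 PM Γ t A ⊢t ρ ρ⊨Γ =
  subst₂ (λ B u → (prod PM ρ ▷ subT (closeSub PM ρ) u) ∈ PhaseModel.⟦ PM ⟧ B)
         (renF-id A) (renAt-id t)
         (sound ⊢t id ρ (subst (ρ ⊨_) (sym (map-renF-id Γ)) ρ⊨Γ))
  where open Soundness PM
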